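{- Let $(\alpha,\beta,\gamma)\in\mathbb{Z}[i]^3$ satisfy $\alpha^2+i\beta^2+\gamma^2=0$, $\alpha\beta\gamma\neq0$ and $\gcd(\alpha,\beta,\gamma)\in U$. Then $\alpha\beta\gamma\equiv 0\pmod{1+i}$.
   Context: $\mathbb{Z}[i]$ is the ring of Gaussian integers and $U=\{1,-1,i,-i\}$ its unit group. Congruences modulo $\mu$ mean divisibility by $\mu$ in $\mathbb{Z}[i]$. "$\gcd(\alpha,\beta,\gamma)\in U$" means $\alpha,\beta,\gamma$ have no common non-unit divisor. -}

module Defs where

open import Data.Integer as ℤ using (ℤ; +_; -[1+_])
open import Data.Product using (Σ; _×_; _,_)
open import Data.Sum using (_⊎_)
open import Relation.Binary.PropositionalEquality using (_≡_)
open import Relation.Nullary using (¬_)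

record ℤ[i] : Set where
  constructor _+_i
  field
    re : ℤ
    im : ℤ
open ℤ[i] public

infixl 6 _+ᵍ_
infixl 7 _*ᵍ_

_+ᵍ_ : ℤ[i] → ℤ[i] → ℤ[i]
(a + b i) +ᵍ (c + d i) = (a ℤ.+ c) + (b ℤ.+ d) i

_*ᵍ_ : ℤ[i] → ℤ[i] → ℤ[i]
(a + b i) *ᵍ (c + d i) = (a ℤ.* c ℤ.- b ℤ.* d) + (a ℤ.* d ℤ.+ b ℤ.* c) i

0ᵍ 1ᵍ iᵍ : ℤ[i]
0ᵍ = (+ 0) + (+ 0) i
1ᵍ = (+ 1) + (+ 0) i
iᵍ = (+ 0) + (+ 1) i

1+iᵍ : ℤ[i]
1+iᵍ = (+ 1) + (+ 1) i

_²ᵍ : ℤ[i] → ℤ[i]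
x ²ᵍ = x *ᵍ x

infix 4 _∣ᵍ_
_∣ᵍ_ : ℤ[i] → ℤ[i] → Set
μ ∣ᵍ α = Σ ℤ[i] λ κ → α ≡ κ *ᵍ μ

IsUnitᵍ : ℤ[i] → Set
IsUnitᵍ u = (u ≡ (+ 1) + (+ 0) i) ⊎ (u ≡ -[1+ 0 ] + (+ 0) i)
          ⊎ (u ≡ (+ 0) + (+ 1) i) ⊎ (u ≡ (+ 0) + -[1+ 0 ] i)

GcdUnit3 : ℤ[i] → ℤ[i] → ℤ[i] → Set
GcdUnit3 α β γ = ∀ δ → δ ∣ᵍ α → δ ∣ᵍ β → δ ∣ᵍ γ → IsUnitᵍ δ

-- Writing β = a + b i, it reads
-- 2 (re α im α + re γ im γ) + a² − b² = 0, so 2 divides a² − b² = (a − b)² + 2 b (a − b),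
-- hence 2 divides a − b because 2 is prime, and then 1 + i divides β.
module Submission where

open import Defs
open import Data.Integer using (ℤ; +_; -_; _+_; _-_; _*_; ∣_∣)
open import Data.Integer.Divisibility.Signed
  using (_∣_; divides; ∣ᵤ⇒∣; ∣⇒∣ᵤ; ∣m+n∣n⇒∣m)
open import Data.Integer.Properties using (abs-*)
open import Data.Integer.Tactic.RingSolver using (solve-∀)
open import Data.Nat.Divisibility using () renaming (_∣_ to _∣ℕ_)
open import Data.Nat.Primality using (Prime; euclidsLemma; prime[2])
open import Data.Product using (_,_)
open import Data.Sum using ([_,_])
open import Function using (id)
open import Relation.Binary.PropositionalEquality
  using (_≡_; refl; sym; trans; cong; cong₂; subst; module ≡-Reasoning)
open import Relation.Nullary using (¬_)

*ᵍ-comm : ∀ x y → x *ᵍ y ≡ y *ᵍ x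
*ᵍ-comm (a + b i) (c + d i) = cong₂ _+_i (re-comm a b c d) (im-comm a b c d)
  where
  re-comm : ∀ a b c d → a * c - b * d ≡ c * a - d * b
  re-comm = solve-∀
  im-comm : ∀ a b c d → a * d + b * c ≡ c * b + d * a
  im-comm = solve-∀

*ᵍ-assoc : ∀ x y z → x *ᵍ y *ᵍ z ≡ x *ᵍ (y *ᵍ z)
*ᵍ-assoc (a + b i) (c + d i) (e + f i) = cong₂ _+_i (re-assoc a b c d e f) (im-assoc a b c d e f)
  where
  re-assoc : ∀ a b c d e f → (a * c - b * d) * e - (a * d + b * c) * f
                           ≡ a * (c * e - d * f) - b * (c * f + d * e)
  re-assoc = solve-∀
  im-assoc : ∀ a b c d e f → (a * c - b * d) * f + (a * d + b * c) * e
                           ≡ a * (c * f + d * e) + b * (c * e - d * f)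
  im-assoc = solve-∀

∣ᵍ⇒∣ᵍ*ˡ : ∀ {μ β} α → μ ∣ᵍ β → μ ∣ᵍ α *ᵍ β
∣ᵍ⇒∣ᵍ*ˡ {μ} {β} α (κ , β≡κμ) = α *ᵍ κ , (begin
  α *ᵍ β         ≡⟨ cong (α *ᵍ_) β≡κμ ⟩
  α *ᵍ (κ *ᵍ μ)  ≡⟨ sym (*ᵍ-assoc α κ μ) ⟩
  α *ᵍ κ *ᵍ μ    ∎)
  where open ≡-Reasoning

∣ᵍ⇒∣ᵍ*ʳ : ∀ {μ α} γ → μ ∣ᵍ α → μ ∣ᵍ α *ᵍ γ
∣ᵍ⇒∣ᵍ*ʳ {μ} {α} γ μ∣α = subst (μ ∣ᵍ_) (*ᵍ-comm γ α) (∣ᵍ⇒∣ᵍ*ˡ γ μ∣α)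

p∣n*n⇒p∣n : ∀ {p} n → Prime p → + p ∣ n * n → + p ∣ n
p∣n*n⇒p∣n {p} n pp p∣n*n =
  ∣ᵤ⇒∣ ([ id , id ] (euclidsLemma ∣ n ∣ ∣ n ∣ pp (subst (p ∣ℕ_) (abs-* n n) (∣⇒∣ᵤ p∣n*n))))

2∣a-b⇒1+i∣a+bi : ∀ {a b} → + 2 ∣ a - b → 1+iᵍ ∣ᵍ a + b i
2∣a-b⇒1+i∣a+bi {a} {b} (divides k a-b≡k*2) = (b + k) + - k i , cong₂ _+_i re-eq (im-eq b k)
  where
  open ≡-Reasoning
  re-eq : a ≡ (b + k) * + 1 - - k * + 1
  re-eq = begin
    a                          ≡⟨ a≡a-b+b a b ⟩
    a - b + b                  ≡⟨ cong₂ _+_ a-b≡k*2 refl ⟩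
    k * + 2 + b                ≡⟨ k*2+b≡re b k ⟩
    (b + k) * + 1 - - k * + 1  ∎
    where
    a≡a-b+b : ∀ a b → a ≡ a - b + b
    a≡a-b+b = solve-∀
    k*2+b≡re : ∀ b k → k * + 2 + b ≡ (b + k) * + 1 - - k * + 1
    k*2+b≡re = solve-∀
  im-eq : ∀ b k → b ≡ (b + k) * + 1 + - k * + 1
  im-eq = solve-∀

im-α²+iβ²+γ² : ∀ α β γ → im (α ²ᵍ +ᵍ iᵍ *ᵍ β ²ᵍ +ᵍ γ ²ᵍ)
  ≡ (re β - im β) * (re β - im β)
    + (re α * im α + re γ * im γ + im β * (re β - im β)) * + 2
im-α²+iβ²+γ² (a + b i) (c + d i) (e + f i) = identity a b c d e f
  where
  -- the left side is the imaginary part unfolded, as the ring solver needs it literally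
  identity : ∀ a b c d e f →
      a * b + b * a
      + (+ 0 * (c * d + d * c) + + 1 * (c * c - d * d))
      + (e * f + f * e)
    ≡ (c - d) * (c - d) + (a * b + e * f + d * (c - d)) * + 2
  identity = solve-∀

α²+iβ²+γ²≡0⇒2∣re-im : ∀ {α β γ} → α ²ᵍ +ᵍ iᵍ *ᵍ β ²ᵍ +ᵍ γ ²ᵍ ≡ 0ᵍ → + 2 ∣ re β - im β
α²+iβ²+γ²≡0⇒2∣re-im {α} {β} {γ} eq =
  p∣n*n⇒p∣n d prime[2] (∣m+n∣n⇒∣m 2∣d*d+k*2 (divides k refl))
  where
  d k : ℤ
  d = re β - im β
  k = re α * im α + re γ * im γ + im β * d
  2∣d*d+k*2 : + 2 ∣ d * d + k * + 2
  2∣d*d+k*2 = subst (+ 2 ∣_) (trans (sym (cong im eq)) (im-α²+iβ²+γ² α β γ)) (divides (+ 0) refl)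

lemma4p5 : (α β γ : ℤ[i]) →
    α ²ᵍ +ᵍ iᵍ *ᵍ β ²ᵍ +ᵍ γ ²ᵍ ≡ 0ᵍ →
    ¬ (α *ᵍ β *ᵍ γ ≡ 0ᵍ) →
    GcdUnit3 α β γ →
    1+iᵍ ∣ᵍ α *ᵍ β *ᵍ γ
lemma4p5 α β γ eq _ _ = ∣ᵍ⇒∣ᵍ*ʳ γ (∣ᵍ⇒∣ᵍ*ˡ α 1+i∣β)
  where
  1+i∣β : 1+iᵍ ∣ᵍ β
  1+i∣β = 2∣a-b⇒1+i∣a+bi (α²+iβ²+γ²≡0⇒2∣re-im {α} {β} {γ} eq)
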